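{- Let $\Omega=(\omega,d_\omega)$ with $d_\omega(x,y)=\max\{x,y\}$ for $x\ne y$, $d_\omega(x,x)=0$, and let $\Omega^<=(\omega,d_\omega,<)$ with $<$ the usual order. Let $q:\Omega\to\Omega$ be any non-expansive surjection, and let $\sqsubset$ be the linear order on $\omega$ defined by $a\sqsubset b$ iff $\min q^{ -1}(a)<\min q^{ -1}(b)$ (the unique linear order making $q:(\omega,<)\to(\omega,\sqsubset)$ a rigid surjection). Then there exists a map $r:\omega\to\omega$ which is a non-expansive rigid surjection from $(\omega,d_\omega,\sqsubset)$ to $\Omega^<$.
   Context: A map $f:(M,d)\to(M',d')$ is non-expansive if $d'(f(x),f(y))\le d(x,y)$. For well-ordered chains $(A,\prec)$, $(B,\prec')$, a surjection $f:A\to B$ is a rigid surjection if $b_1\prec' b_2$ implies $\min_\prec f^{ -1}(b_1)\prec\min_\prec f^{ -1}(b_2)$. A non-expansive rigid surjection between linearly ordered metric spaces is a map that is both non-expansive and a rigid surjection of the underlying chains. (The order $\sqsubset$ has order type $\omega$.) -}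

module Defs where

open import Data.Nat using (ℕ; _≤_; _<_; _⊔_)
open import Data.Nat.Properties using (_≟_)
open import Data.Product using (Σ; _×_; ∃; ∃-syntax)
open import Data.Sum using (_⊎_)
open import Relation.Binary.PropositionalEquality using (_≡_)
open import Relation.Nullary using (yes; no)

dω : ℕ → ℕ → ℕ
dω x y with x ≟ y
... | yes _ = 0
... | no _ = x ⊔ y

NonExpansive : (ℕ → ℕ) → Set
NonExpansive f = ∀ x y → dω (f x) (f y) ≤ dω x y

Surjective : (ℕ → ℕ) → Set
Surjective f = ∀ b → ∃[ a ] f a ≡ b

IsMinPreimage : (_≺_ : ℕ → ℕ → Set) → (ℕ → ℕ) → ℕ → ℕ → Set
IsMinPreimage _≺_ f b m = (f m ≡ b) × (∀ k → f k ≡ b → (m ≡ k) ⊎ (m ≺ k))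

_⊏[_]_ : ℕ → (ℕ → ℕ) → ℕ → Set
a ⊏[ q ] b = Σ ℕ λ ma → Σ ℕ λ mb →
  IsMinPreimage _<_ q a ma × IsMinPreimage _<_ q b mb × (ma < mb)

RigidSurjection : (_≺_ : ℕ → ℕ → Set) → (ℕ → ℕ) → Set
RigidSurjection _≺_ f =
  Surjective f ×
  (∀ b₁ b₂ → b₁ < b₂ →
     Σ ℕ λ m₁ → Σ ℕ λ m₂ →
       IsMinPreimage _≺_ f b₁ m₁ × IsMinPreimage _≺_ f b₂ m₂ × (m₁ ≺ m₂))

-- The order ⊏ enumerates the values of q as q x₀, q x₁, … along their first
-- occurrences x₀ < x₁ < ⋯.  A counter c, starting at 0, walks along this
-- enumeration; it is assigned to the value q xᵢ and then incremented whenever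
-- c ≤ q xᵢ, and every value a receives r a = min (a , c) with c the counter at
-- the first occurrence of a.  Then r a ≤ a, which already makes r non-expansive.  Since values beyond any bound
-- keep occurring, the counter passes every v, and v is first reached by r
-- exactly at the value where the counter steps from v to v + 1; these values
-- come in ⊏-order.
module Submission where

open import Defs
open import Data.Nat using (ℕ; zero; suc; _≤_; _<_; _+_; _⊔_; _⊓_; z≤n; s≤s; _≤?_; _<?_)
open import Data.Nat.Induction using (<-rec)
open import Data.Nat.Properties
open import Data.Product using (_×_; _,_; proj₁; proj₂; ∃-syntax)
open import Data.Sum using (_⊎_; inj₁; inj₂; swap)
open import Level using (0ℓ)
open import Relation.Binary.PropositionalEquality
open import Relation.Nullary using (yes; no; contradiction)
open import Relation.Nullary.Decidable using (_×-dec_)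
open import Relation.Unary using (Pred; Decidable)

dω-self : ∀ x → dω x x ≡ 0
dω-self x with x ≟ x
... | yes _ = refl
... | no x≢x = contradiction refl x≢x

dω≤⊔ : ∀ x y → dω x y ≤ x ⊔ y
dω≤⊔ x y with x ≟ y
... | yes _ = z≤n
... | no _ = ≤-refl

deflationary⇒nonExpansive : ∀ {f} → (∀ x → f x ≤ x) → NonExpansive f
deflationary⇒nonExpansive {f} f≤id x y with x ≟ y
... | yes refl = ≤-trans (≤-reflexive (dω-self (f x))) z≤n
... | no _ = begin
  dω (f x) (f y)  ≤⟨ dω≤⊔ (f x) (f y) ⟩
  f x ⊔ f y       ≤⟨ ⊔-mono-≤ (f≤id x) (f≤id y) ⟩
  x ⊔ y           ∎
  where open ≤-Reasoning

least : ∀ {P : Pred ℕ 0ℓ} → Decidable P → ∀ n → P n → ∃[ m ] P m × (∀ k → P k → m ≤ k)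
least {P} P? = <-rec (λ n → P n → ∃[ m ] P m × (∀ k → P k → m ≤ k)) search
  where
  search : ∀ n → (∀ {k} → k < n → P k → ∃[ m ] P m × (∀ k → P k → m ≤ k)) →
           P n → ∃[ m ] P m × (∀ k → P k → m ≤ k)
  search n rec Pn with anyUpTo? P? n
  ... | yes (k , k<n , Pk) = rec k<n Pk
  ... | no none = n , Pn , λ k Pk → ≮⇒≥ (λ k<n → none (k , k<n , Pk))

prefixMax : (ℕ → ℕ) → ℕ → ℕ
prefixMax f zero = 0
prefixMax f (suc n) = f n ⊔ prefixMax f n

≤-prefixMax : ∀ f {x n} → x < n → f x ≤ prefixMax f n
≤-prefixMax f {x} {suc n} (s≤s x≤n) with m≤n⇒m<n∨m≡n x≤n
... | inj₁ x<n = ≤-trans (≤-prefixMax f x<n) (m≤n⊔m (f n) (prefixMax f n))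
... | inj₂ refl = m≤m⊔n (f n) (prefixMax f n)

stepwise-mono : ∀ {f : ℕ → ℕ} → (∀ x → f x ≤ f (suc x)) → ∀ {x y} → x ≤ y → f x ≤ f y
stepwise-mono {f} step {x} x≤y with m≤n⇒∃[o]m+o≡n x≤y
... | o , refl = go o
  where
  go : ∀ o → f x ≤ f (x + o)
  go zero = ≤-reflexive (cong f (sym (+-identityʳ x)))
  go (suc o) = ≤-trans (go o)
                (≤-trans (step (x + o)) (≤-reflexive (cong f (sym (+-suc x o)))))

unitStep-ivt : ∀ {f : ℕ → ℕ} → (∀ x → f (suc x) ≤ suc (f x)) →
               ∀ {v} n → f 0 ≤ v → v < f n → ∃[ x ] f x ≡ v × f (suc x) ≡ suc v
unitStep-ivt step zero f0≤v v<f0 = contradiction f0≤v (<⇒≱ v<f0)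
unitStep-ivt {f} step {v} (suc n) f0≤v v<f1+n with v <? f n
... | yes v<fn = unitStep-ivt step n f0≤v v<fn
... | no v≮fn = n , fn≡v , ≤-antisym (≤-trans (step n) (s≤s (≤-reflexive fn≡v))) v<f1+n
  where
  fn≡v : f n ≡ v
  fn≡v = ≤-antisym (≮⇒≥ v≮fn) (≤-pred (≤-trans v<f1+n (step n)))

module Construction (q : ℕ → ℕ) (q-surj : Surjective q) where

  leastPreimage : ∀ b → ∃[ m ] q m ≡ b × (∀ k → q k ≡ b → m ≤ k)
  leastPreimage b = least (λ x → q x ≟ b) (proj₁ (q-surj b)) (proj₂ (q-surj b))

  minPre : ℕ → ℕ
  minPre b = proj₁ (leastPreimage b)

  q-minPre : ∀ b → q (minPre b) ≡ b
  q-minPre b = proj₁ (proj₂ (leastPreimage b))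

  minPre-≤ : ∀ {b k} → q k ≡ b → minPre b ≤ k
  minPre-≤ {b} {k} = proj₂ (proj₂ (leastPreimage b)) k

  minPre-isMin : ∀ b → IsMinPreimage _<_ q b (minPre b)
  minPre-isMin b = q-minPre b , λ k qk≡b → swap (m≤n⇒m<n∨m≡n (minPre-≤ qk≡b))

  ⊏-intro : ∀ {a b} → minPre a < minPre b → a ⊏[ q ] b
  ⊏-intro {a} {b} lt = minPre a , minPre b , minPre-isMin a , minPre-isMin b , lt

  IsNew : ℕ → Set
  IsNew x = minPre (q x) ≡ x

  minPre-new : ∀ b → IsNew (minPre b)
  minPre-new b = cong minPre (q-minPre b)

  Selects : ℕ → ℕ → Set
  Selects x c = IsNew x × c ≤ q x

  tick : ℕ → ℕ → ℕ
  tick x c with (minPre (q x) ≟ x) ×-dec (c ≤? q x)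
  ... | yes _ = suc c
  ... | no _ = c

  count : ℕ → ℕ
  count zero = 0
  count (suc x) = tick x (count x)

  tick-selects : ∀ {x c} → Selects x c → tick x c ≡ suc c
  tick-selects {x} {c} sel with (minPre (q x) ≟ x) ×-dec (c ≤? q x)
  ... | yes _ = refl
  ... | no ¬sel = contradiction sel ¬sel

  tick≡suc⇒selects : ∀ {x c} → tick x c ≡ suc c → Selects x c
  tick≡suc⇒selects {x} {c} eq with (minPre (q x) ≟ x) ×-dec (c ≤? q x)
  ... | yes sel = sel
  ... | no _ = contradiction eq (<⇒≢ (n<1+n c))

  ≤-tick : ∀ x c → c ≤ tick x c
  ≤-tick x c with (minPre (q x) ≟ x) ×-dec (c ≤? q x)
  ... | yes _ = n≤1+n c
  ... | no _ = ≤-refl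

  tick-≤ : ∀ x c → tick x c ≤ suc c
  tick-≤ x c with (minPre (q x) ≟ x) ×-dec (c ≤? q x)
  ... | yes _ = ≤-refl
  ... | no _ = n≤1+n c

  tick-passes : ∀ {x c v} → IsNew x → v ≤ c → v < q x → v < tick x c
  tick-passes {x} {c} new v≤c v<qx with ≤-<-connex c (q x)
  ... | inj₁ c≤qx = subst (_ <_) (sym (tick-selects (new , c≤qx))) (s≤s v≤c)
  ... | inj₂ qx<c = <-≤-trans v<qx (≤-trans (<⇒≤ qx<c) (≤-tick x c))

  count-mono : ∀ {x y} → x ≤ y → count x ≤ count y
  count-mono = stepwise-mono (λ x → ≤-tick x (count x))

  -- The first occurrence of a value above q 0, …, q (n - 1) and count n lies
  -- beyond n, and there the counter is passed.
  count-grows : ∀ n → ∃[ n' ] count n < count n'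
  count-grows n =
    suc x , tick-passes (minPre-new a) (count-mono n≤x) (<-≤-trans count<a qx≥a)
    where
    a = suc (prefixMax q n ⊔ count n)
    x = minPre a
    qx≥a : a ≤ q x
    qx≥a = ≤-reflexive (sym (q-minPre a))
    n≤x : n ≤ x
    n≤x = ≮⇒≥ λ x<n →
      <⇒≱ (≤-trans (s≤s (≤-trans (≤-prefixMax q x<n) (m≤m⊔n _ _))) qx≥a) ≤-refl
    count<a : count n < a
    count<a = s≤s (m≤n⊔m (prefixMax q n) (count n))

  count-unbounded : ∀ v → ∃[ n ] v < count n
  count-unbounded zero = count-grows 0
  count-unbounded (suc v) with count-unbounded v
  ... | n , v<cn with count-grows n
  ...   | n' , cn<cn' = n' , <-≤-trans (s≤s v<cn) cn<cn'

  jump : ∀ v → ∃[ x ] count x ≡ v × count (suc x) ≡ suc v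
  jump v with count-unbounded v
  ... | n , v<cn = unitStep-ivt (λ x → tick-≤ x (count x)) n z≤n v<cn

  pivot : ℕ → ℕ
  pivot v = proj₁ (jump v)

  count-pivot : ∀ v → count (pivot v) ≡ v
  count-pivot v = proj₁ (proj₂ (jump v))

  pivot-selects : ∀ v → Selects (pivot v) v
  pivot-selects v = tick≡suc⇒selects
    (subst (λ c → tick (pivot v) c ≡ suc v) (count-pivot v) (proj₂ (proj₂ (jump v))))

  pivot-new : ∀ v → IsNew (pivot v)
  pivot-new v = proj₁ (pivot-selects v)

  pivot-strictMono : ∀ {v w} → v < w → pivot v < pivot w
  pivot-strictMono {v} {w} v<w = ≰⇒> λ pw≤pv →
    <⇒≱ v<w (subst₂ _≤_ (count-pivot w) (count-pivot v) (count-mono pw≤pv))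

  r : ℕ → ℕ
  r a = a ⊓ count (minPre a)

  r≤id : ∀ a → r a ≤ a
  r≤id a = m⊓n≤m a (count (minPre a))

  r-pivot : ∀ v → r (q (pivot v)) ≡ v
  r-pivot v = begin
    q p ⊓ count (minPre (q p))  ≡⟨ cong (λ x → q p ⊓ count x) (pivot-new v) ⟩
    q p ⊓ count p               ≡⟨ cong (q p ⊓_) (count-pivot v) ⟩
    q p ⊓ v                     ≡⟨ m≥n⇒m⊓n≡n (proj₂ (pivot-selects v)) ⟩
    v                           ∎
    where
    open ≡-Reasoning
    p = pivot v

  -- A first occurrence x before pivot v with r (q x) ≡ v would already have
  -- found the counter at v and moved it on.
  pivot-≤-minPre : ∀ {k v} → r k ≡ v → pivot v ≤ minPre k
  pivot-≤-minPre {k} {v} rk≡v = ≮⇒≥ λ x<pv →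
    <⇒≱ (≤-reflexive (sym (count-jumps x<pv))) (count-≤ x<pv)
    where
    x = minPre k
    count-≤ : x < pivot v → count (suc x) ≤ v
    count-≤ x<pv = ≤-trans (count-mono x<pv) (≤-reflexive (count-pivot v))
    count≡v : x < pivot v → count x ≡ v
    count≡v x<pv = ≤-antisym (≤-trans (count-mono (n≤1+n x)) (count-≤ x<pv))
                             (subst (_≤ count x) rk≡v (m⊓n≤n k (count x)))
    v≤qx : v ≤ q x
    v≤qx = subst₂ _≤_ rk≡v (sym (q-minPre k)) (r≤id k)
    count-jumps : x < pivot v → count (suc x) ≡ suc v
    count-jumps x<pv rewrite count≡v x<pv = tick-selects (minPre-new k , v≤qx)

  r-isMin : ∀ v → IsMinPreimage (λ a b → a ⊏[ q ] b) r v (q (pivot v))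
  r-isMin v = r-pivot v , λ k rk≡v → earliest k (m≤n⇒m<n∨m≡n (pivot-≤-minPre rk≡v))
    where
    earliest : ∀ k → pivot v < minPre k ⊎ pivot v ≡ minPre k →
               (q (pivot v) ≡ k) ⊎ (q (pivot v) ⊏[ q ] k)
    earliest k (inj₁ pv<x) = inj₂ (⊏-intro (subst (_< minPre k) (sym (pivot-new v)) pv<x))
    earliest k (inj₂ pv≡x) = inj₁ (trans (cong q pv≡x) (q-minPre k))

  r-rigid : RigidSurjection (λ a b → a ⊏[ q ] b) r
  r-rigid = (λ v → q (pivot v) , r-pivot v) ,
            λ v w v<w → q (pivot v) , q (pivot w) , r-isMin v , r-isMin w ,
              ⊏-intro (subst₂ _<_ (sym (pivot-new v)) (sym (pivot-new w))
                                  (pivot-strictMono v<w))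

mainTheorem5 : (q : ℕ → ℕ) → NonExpansive q → Surjective q →
    ∃[ r ] (NonExpansive r × RigidSurjection (λ a b → a ⊏[ q ] b) r)
mainTheorem5 q _ q-surj = r , deflationary⇒nonExpansive r≤id , r-rigid
  where open Construction q q-surj
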